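{- Let an abstract geometry have $n$ points, with every line containing at most $3$ points, and let each point be colored red or blue. Then the number of monochromatic lines is at least $\frac{n^2}{24} - \frac{n}{6} + \frac{t_2}{6}$, where $t_2$ is the number of lines containing exactly $2$ points.
   Context: An abstract geometry consists of a set of points together with a collection of subsets of the points, called lines, such that each line contains at least two points and any two distinct points are contained in a unique line. A line is monochromatic if all its points have the same color. -}

module Defs where

open import Data.Nat using (ℕ; _≟_)
open import Data.Bool using (Bool; true; false)
open import Data.Fin using (Fin)
open import Data.Fin.Subset using (Subset; _∈_; ∣_∣)
open import Data.Fin.Subset.Properties using (_∈?_)
open import Data.Fin.Properties using (all?)
open import Data.List using (List; length; filter)
open import Data.List.Membership.Propositional renaming (_∈_ to _∈L_)
open import Data.List.Relation.Unary.Unique.Propositional using (Unique)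
open import Data.Product using (_×_; ∃-syntax)
open import Data.Sum using (_⊎_)
open import Relation.Binary.PropositionalEquality using (_≡_)
open import Relation.Nullary using (¬_; Dec; yes; no)
open import Relation.Nullary.Decidable using (_⊎-dec_; _→-dec_)
open import Data.Bool.Properties renaming (_≟_ to _≟B_)

-- Colours: true = red, false = blue.
Colouring : ℕ → Set
Colouring n = Fin n → Bool

record Geometry (n : ℕ) : Set where
  field
    lines       : List (Subset n)
    distinct    : Unique lines
    lineSize≥2  : ∀ ℓ → ℓ ∈L lines → 2 Data.Nat.≤ ∣ ℓ ∣
    joinExists  : ∀ p q → ¬ p ≡ q → ∃[ ℓ ] (ℓ ∈L lines × p ∈ ℓ × q ∈ ℓ)
    joinUnique  : ∀ p q → ¬ p ≡ q → ∀ ℓ ℓ′ → ℓ ∈L lines → ℓ′ ∈L lines →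
                  p ∈ ℓ → q ∈ ℓ → p ∈ ℓ′ → q ∈ ℓ′ → ℓ ≡ ℓ′

open Geometry public

Monochromatic : ∀ {n} → Colouring n → Subset n → Set
Monochromatic c ℓ = (∀ p → p ∈ ℓ → c p ≡ true) ⊎ (∀ p → p ∈ ℓ → c p ≡ false)

monochromatic? : ∀ {n} (c : Colouring n) (ℓ : Subset n) → Dec (Monochromatic c ℓ)
monochromatic? c ℓ =
  all? (λ p → (p ∈? ℓ) →-dec (c p ≟B true)) ⊎-dec all? (λ p → (p ∈? ℓ) →-dec (c p ≟B false))

monoCount : ∀ {n} → Geometry n → Colouring n → ℕ
monoCount G c = length (filter (monochromatic? c) (lines G))

t₂ : ∀ {n} → Geometry n → ℕ
t₂ G = length (filter (λ ℓ → ∣ ℓ ∣ ≟ 2) (lines G))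

-- Two distinct points lie on exactly one line, so counting the ordered pairs of
-- distinct points of a point set Y line by line gives
-- Σ_ℓ |ℓ ∩ Y|(|ℓ ∩ Y| − 1) = |Y|(|Y| − 1). A line with r red and b blue points,
-- r + b ∈ {2, 3}, satisfies 6r(r−1) + 6b(b−1) + 4[r + b = 2]
-- ≤ 24[r = 0 or b = 0] + 2(r + b)(r + b − 1), as the seven cases show. Summing over
-- the lines, with R red and B blue points and M monochromatic lines,
-- 6R(R−1) + 6B(B−1) + 4t₂ ≤ 24M + 2n(n−1), and 2(R² + B²) ≥ (R + B)² = n² finishes.
module Submission where

open import Defs
open import Data.Nat using (ℕ; _+_; _*_; _≤_)
open import Data.Fin.Subset using (∣_∣)
open import Data.List.Membership.Propositional using (_∈_)

open import Algebra.Bundles using (CommutativeMonoid)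
open import Data.Bool using (Bool; true; false; _∧_; not)
open import Data.Bool.Properties using (∧-commutativeMonoid; ∧-conicalˡ; ∧-conicalʳ; ∧-identityʳ; not-injective)
open import Data.Empty using (⊥-elim)
open import Data.Fin using (Fin; zero; suc)
import Data.Fin.Properties as Fin
open import Data.Fin.Subset using (Subset)
open import Data.List as List using (List; []; _∷_; length; filter)
open import Data.List.Membership.Propositional.Properties using (∈-lookup)
import Data.List.Relation.Unary.All as All
open import Data.List.Relation.Unary.Any using (here; there)
open import Data.List.Relation.Unary.AllPairs using (_∷_)
open import Data.List.Relation.Unary.Unique.Propositional using (Unique)
open import Data.Nat using (zero; suc; pred; z≤n; s≤s; _≟_)
open import Data.Nat.Properties
open import Data.Nat.Tactic.RingSolver using (solve)
open import Data.Product using (_,_)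
open import Data.Sum using (_⊎_; inj₁; inj₂)
open import Data.Vec as Vec using (lookup)
open import Data.Vec.Functional using (Vector; zipWith; map; replicate)
open import Data.Vec.Properties using ([]=⇒lookup; lookup⇒[]=)
open import Function using (_∘_)
open import Relation.Binary.PropositionalEquality
open import Relation.Nullary using (¬_; Dec; yes; no; does)
open import Relation.Nullary.Decidable using (dec-true)
open import Relation.Unary using (Decidable)
open import Algebra.Properties.Semiring.Sum +-*-semiring
  using (sum; sum-syntax; sum-cong-≗; ∑-distrib-+; ∑-comm; *-distribˡ-sum; *-distribʳ-sum)
import Algebra.Properties.CommutativeSemigroup as CommSemigroupProperties

module ∧ = CommSemigroupProperties (CommutativeMonoid.commutativeSemigroup ∧-commutativeMonoid)

𝟙 : Bool → ℕ
𝟙 true  = 1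
𝟙 false = 0

𝟙-∧ : ∀ a b → 𝟙 (a ∧ b) ≡ 𝟙 a * 𝟙 b
𝟙-∧ true  b = sym (*-identityˡ (𝟙 b))
𝟙-∧ false b = refl

𝟙-idem : ∀ a → 𝟙 a * 𝟙 a ≡ 𝟙 a
𝟙-idem true  = refl
𝟙-idem false = refl

𝟙-split : ∀ a b → 𝟙 a ≡ 𝟙 (a ∧ b) + 𝟙 (a ∧ not b)
𝟙-split true  true  = refl
𝟙-split true  false = refl
𝟙-split false b     = refl

𝟙≡0⇒false : ∀ {a} → 𝟙 a ≡ 0 → a ≡ false
𝟙≡0⇒false {false} _ = refl

𝟙-regroup : ∀ e a b c d → 𝟙 (e ∧ (a ∧ b) ∧ (c ∧ d)) ≡ 𝟙 (a ∧ c) * 𝟙 (e ∧ b ∧ d)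
𝟙-regroup e a b c d =
  trans (cong 𝟙 (trans (cong (e ∧_) (∧.interchange a b c d)) (∧.x∙yz≈y∙xz e (a ∧ c) (b ∧ d))))
        (𝟙-∧ (a ∧ c) (e ∧ b ∧ d))

x*𝟙[¬P∧b]≡𝟙[¬P∧b] : ∀ {P : Set} (P? : Dec P) {x} b → (¬ P → x ≡ 1) →
                      x * 𝟙 (not (does P?) ∧ b) ≡ 𝟙 (not (does P?) ∧ b)
x*𝟙[¬P∧b]≡𝟙[¬P∧b] (yes _) {x} b _    = *-zeroʳ x
x*𝟙[¬P∧b]≡𝟙[¬P∧b] (no ¬p)     b x≡1 = trans (cong (_* 𝟙 b) (x≡1 ¬p)) (*-identityˡ (𝟙 b))

∑-mono-≤ : ∀ {n} {f g : Vector ℕ n} → (∀ i → f i ≤ g i) → sum f ≤ sum g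
∑-mono-≤ {zero}  f≤g = z≤n
∑-mono-≤ {suc n} f≤g = +-mono-≤ (f≤g zero) (∑-mono-≤ (f≤g ∘ suc))

∑-linear : ∀ {n} a b (f g : Vector ℕ n) → ∑[ i < n ] (a * f i + b * g i) ≡ a * sum f + b * sum g
∑-linear a b f g = trans (∑-distrib-+ (λ i → a * f i) (λ i → b * g i))
                         (sym (cong₂ _+_ (*-distribˡ-sum a f) (*-distribˡ-sum b g)))

-- Indexed by positions, so that the library's lemmas on finite sums apply.
∑ˡ : ∀ {A : Set} → List A → (A → ℕ) → ℕ
∑ˡ xs f = ∑[ k < length xs ] f (List.lookup xs k)

module _ {A : Set} where

  length-filter≡∑ˡ : ∀ {P : A → Set} (P? : Decidable P) xs →
                     length (filter P? xs) ≡ ∑ˡ xs (λ x → 𝟙 (does (P? x)))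
  length-filter≡∑ˡ P? [] = refl
  length-filter≡∑ˡ P? (x ∷ xs) with does (P? x)
  ... | true  = cong suc (length-filter≡∑ˡ P? xs)
  ... | false = length-filter≡∑ˡ P? xs

  ∑ˡ-𝟙-none : ∀ xs (f : A → Bool) → (∀ {y} → y ∈ xs → f y ≡ false) → ∑ˡ xs (𝟙 ∘ f) ≡ 0
  ∑ˡ-𝟙-none []       f none = refl
  ∑ˡ-𝟙-none (x ∷ xs) f none rewrite none (here refl) = ∑ˡ-𝟙-none xs f (none ∘ there)

  ∑ˡ-𝟙-unique : ∀ {xs} (f : A → Bool) → Unique xs → ∀ {x} → x ∈ xs → f x ≡ true →
                (∀ {y} → y ∈ xs → f y ≡ true → y ≡ x) → ∑ˡ xs (𝟙 ∘ f) ≡ 1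
  ∑ˡ-𝟙-unique {y ∷ ys} f (y∉ys ∷ !ys) x∈xs fx only with f y in fy
  ... | true  = cong suc (∑ˡ-𝟙-none ys f none)
    where
    none : ∀ {z} → z ∈ ys → f z ≡ false
    none {z} z∈ys with f z in fz
    ... | false = refl
    ... | true  = ⊥-elim (All.lookup y∉ys z∈ys (trans (only (here refl) fy) (sym (only (there z∈ys) fz))))
  ... | false with x∈xs
  ...   | here refl with () ← trans (sym fx) fy
  ...   | there x∈ys = ∑ˡ-𝟙-unique f !ys x∈ys fx (only ∘ there)

m+n≡n*n⇒m≡n*pred[n] : ∀ {m n} → m + n ≡ n * n → m ≡ n * pred n
m+n≡n*n⇒m≡n*pred[n] {m} {zero}  eq = trans (sym (+-identityʳ m)) eq
m+n≡n*n⇒m≡n*pred[n] {m} {suc n} eq =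
  +-cancelʳ-≡ (suc n) m (suc n * n) (trans eq (trans (*-suc (suc n) n) (+-comm (suc n) (suc n * n))))

two-colour-bound : ∀ r b m → 2 ≤ r + b → r + b ≤ 3 → (r ≡ 0 ⊎ b ≡ 0 → m ≡ 1) →
  6 * (r * pred r) + 6 * (b * pred b) + 4 * 𝟙 (does (r + b ≟ 2)) ≤ 24 * m + 2 * ((r + b) * pred (r + b))
two-colour-bound 0 0 m () _ _
two-colour-bound 0 1 m (s≤s ()) _ _
two-colour-bound 1 0 m (s≤s ()) _ _
two-colour-bound 0 2 m _ _ mono rewrite mono (inj₁ refl) = ≤ᵇ⇒≤ _ _ _
two-colour-bound 0 3 m _ _ mono rewrite mono (inj₁ refl) = ≤ᵇ⇒≤ _ _ _
two-colour-bound 2 0 m _ _ mono rewrite mono (inj₂ refl) = ≤ᵇ⇒≤ _ _ _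
two-colour-bound 3 0 m _ _ mono rewrite mono (inj₂ refl) = ≤ᵇ⇒≤ _ _ _
two-colour-bound 1 1 m _ _ _ = m≤n+m 4 (24 * m)
two-colour-bound 1 2 m _ _ _ = m≤n+m 12 (24 * m)
two-colour-bound 2 1 m _ _ _ = m≤n+m 12 (24 * m)
two-colour-bound 0 (suc (suc (suc (suc b)))) m _ (s≤s (s≤s (s≤s ()))) _
two-colour-bound 1 (suc (suc (suc b)))       m _ (s≤s (s≤s (s≤s ()))) _
two-colour-bound 2 (suc (suc b))             m _ (s≤s (s≤s (s≤s ()))) _
two-colour-bound 3 (suc b)                   m _ (s≤s (s≤s (s≤s ()))) _
two-colour-bound (suc (suc (suc (suc r)))) b m _ (s≤s (s≤s (s≤s ()))) _

square-sum≤-ordered : ∀ {r b} → r ≤ b → (r + b) * (r + b) ≤ 2 * (r * r + b * b)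
square-sum≤-ordered {r} r≤b with d , refl ← m≤n⇒∃[o]m+o≡n r≤b = begin
  (r + (r + d)) * (r + (r + d))                  ≤⟨ m≤m+n _ (d * d) ⟩
  (r + (r + d)) * (r + (r + d)) + d * d          ≡⟨ solve (r ∷ d ∷ []) ⟩
  2 * (r * r + (r + d) * (r + d))                ∎
  where open ≤-Reasoning

square-sum≤ : ∀ r b → (r + b) * (r + b) ≤ 2 * (r * r + b * b)
square-sum≤ r b with ≤-total r b
... | inj₁ r≤b = square-sum≤-ordered r≤b
... | inj₂ b≤r = subst₂ _≤_ (cong₂ _*_ (+-comm b r) (+-comm b r)) (cong (2 *_) (+-comm (b * b) (r * r)))
                        (square-sum≤-ordered b≤r)

quadratic-bound : ∀ {r b s dr db d t m} → r + b ≡ s →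
  dr + r ≡ r * r → db + b ≡ b * b → d + s ≡ s * s →
  6 * dr + 6 * db + 4 * t ≤ 24 * m + 2 * d →
  s * s + 4 * t ≤ 24 * m + 4 * s
quadratic-bound {r} {b} {s} {dr} {db} {d} {t} {m} r+b≡s red blue all bound =
  +-cancelʳ-≤ (2 * (s * s) + 2 * s) (s * s + 4 * t) (24 * m + 4 * s) (begin
    s * s + 4 * t + (2 * (s * s) + 2 * s)             ≡⟨ solve (s ∷ t ∷ []) ⟩
    3 * (s * s) + 4 * t + 2 * s                       ≤⟨ +-monoˡ-≤ (2 * s) (+-monoˡ-≤ (4 * t) (*-monoʳ-≤ 3 s*s≤2[r*r+b*b])) ⟩
    3 * (2 * (r * r + b * b)) + 4 * t + 2 * s         ≡⟨ cong₂ (λ x y → 3 * (2 * (x + y)) + 4 * t + 2 * s) red blue ⟨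
    3 * (2 * (dr + r + (db + b))) + 4 * t + 2 * s     ≡⟨ solve (r ∷ b ∷ s ∷ dr ∷ db ∷ t ∷ []) ⟩
    6 * dr + 6 * db + 4 * t + (6 * (r + b) + 2 * s)   ≡⟨ cong (λ x → 6 * dr + 6 * db + 4 * t + (6 * x + 2 * s)) r+b≡s ⟩
    6 * dr + 6 * db + 4 * t + (6 * s + 2 * s)         ≤⟨ +-monoˡ-≤ (6 * s + 2 * s) bound ⟩
    24 * m + 2 * d + (6 * s + 2 * s)                  ≡⟨ solve (s ∷ d ∷ m ∷ []) ⟩
    24 * m + 2 * (d + s) + 6 * s                      ≡⟨ cong (λ x → 24 * m + 2 * x + 6 * s) all ⟩
    24 * m + 2 * (s * s) + 6 * s                      ≡⟨ solve (s ∷ m ∷ []) ⟩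
    24 * m + 4 * s + (2 * (s * s) + 2 * s)            ∎)
  where
  open ≤-Reasoning
  s*s≤2[r*r+b*b] : s * s ≤ 2 * (r * r + b * b)
  s*s≤2[r*r+b*b] = subst (λ x → x * x ≤ 2 * (r * r + b * b)) r+b≡s (square-sum≤ r b)

infixr 7 _∩_
_∩_ : ∀ {n} → Vector Bool n → Vector Bool n → Vector Bool n
_∩_ = zipWith _∧_

∁ : ∀ {n} → Vector Bool n → Vector Bool n
∁ = map not

_≠_ : ∀ {n} → Fin n → Fin n → Bool
i ≠ j = not (does (i Fin.≟ j))

_-_ : ∀ {n} → Vector Bool n → Fin n → Vector Bool n
(Y - i) j = i ≠ j ∧ Y j

size : ∀ {n} → Vector Bool n → ℕ
size {n} Y = ∑[ i < n ] 𝟙 (Y i)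

pairs : ∀ {n} → Vector Bool n → ℕ
pairs {n} Y = ∑[ i < n ] ∑[ j < n ] 𝟙 (i ≠ j ∧ Y i ∧ Y j)

∣p∣≡size : ∀ {n} (p : Subset n) → ∣ p ∣ ≡ size (lookup p)
∣p∣≡size Vec.[]           = refl
∣p∣≡size (true  Vec.∷ p) = cong suc (∣p∣≡size p)
∣p∣≡size (false Vec.∷ p) = ∣p∣≡size p

size-replicate-true : ∀ n → size (replicate n true) ≡ n
size-replicate-true zero    = refl
size-replicate-true (suc n) = cong suc (size-replicate-true n)

size-split : ∀ {n} (Y Z : Vector Bool n) → size Y ≡ size (Y ∩ Z) + size (Y ∩ ∁ Z)
size-split Y Z = trans (sum-cong-≗ (λ i → 𝟙-split (Y i) (Z i))) (∑-distrib-+ (𝟙 ∘ (Y ∩ Z)) (𝟙 ∘ (Y ∩ ∁ Z)))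

size≡0⇒empty : ∀ {n} (Y : Vector Bool n) → size Y ≡ 0 → ∀ i → Y i ≡ false
size≡0⇒empty Y Y≡0 zero    = 𝟙≡0⇒false (m+n≡0⇒m≡0 _ Y≡0)
size≡0⇒empty Y Y≡0 (suc i) = size≡0⇒empty (Y ∘ suc) (m+n≡0⇒n≡0 _ Y≡0) i

size-remove : ∀ {n} (Y : Vector Bool n) i → size Y ≡ size (Y - i) + 𝟙 (Y i)
size-remove Y zero    = +-comm (𝟙 (Y zero)) (size (Y ∘ suc))
size-remove Y (suc i) =
  trans (cong (𝟙 (Y zero) +_) (size-remove (Y ∘ suc) i)) (sym (+-assoc (𝟙 (Y zero)) _ (𝟙 (Y (suc i)))))

pairs-cong : ∀ {n} {Y Z : Vector Bool n} → (∀ i → Y i ≡ Z i) → pairs Y ≡ pairs Z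
pairs-cong {Y = Y} {Z} Y≗Z = sum-cong-≗ λ i → sum-cong-≗ λ j →
  cong₂ (λ x y → 𝟙 (i ≠ j ∧ x ∧ y)) (Y≗Z i) (Y≗Z j)

pairs+size≡size² : ∀ {n} (Y : Vector Bool n) → pairs Y + size Y ≡ size Y * size Y
pairs+size≡size² {n} Y = begin
  pairs Y + size Y                                        ≡⟨ ∑-distrib-+ (λ i → ∑[ j < n ] 𝟙 (i ≠ j ∧ Y i ∧ Y j)) (𝟙 ∘ Y) ⟨
  ∑[ i < n ] (∑[ j < n ] 𝟙 (i ≠ j ∧ Y i ∧ Y j) + 𝟙 (Y i))  ≡⟨ sum-cong-≗ row ⟩
  ∑[ i < n ] (𝟙 (Y i) * size Y)                            ≡⟨ *-distribʳ-sum (size Y) (𝟙 ∘ Y) ⟨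
  size Y * size Y                                         ∎
  where
  open ≡-Reasoning
  row : ∀ i → ∑[ j < n ] 𝟙 (i ≠ j ∧ Y i ∧ Y j) + 𝟙 (Y i) ≡ 𝟙 (Y i) * size Y
  row i = begin
    ∑[ j < n ] 𝟙 (i ≠ j ∧ Y i ∧ Y j) + 𝟙 (Y i)
      ≡⟨ cong₂ _+_ (sum-cong-≗ λ j → trans (cong 𝟙 (∧.x∙yz≈y∙xz (i ≠ j) (Y i) (Y j))) (𝟙-∧ (Y i) _))
                   (sym (𝟙-idem (Y i))) ⟩
    ∑[ j < n ] (𝟙 (Y i) * 𝟙 ((Y - i) j)) + 𝟙 (Y i) * 𝟙 (Y i)
      ≡⟨ cong (_+ 𝟙 (Y i) * 𝟙 (Y i)) (*-distribˡ-sum (𝟙 (Y i)) (𝟙 ∘ (Y - i))) ⟨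
    𝟙 (Y i) * size (Y - i) + 𝟙 (Y i) * 𝟙 (Y i)
      ≡⟨ *-distribˡ-+ (𝟙 (Y i)) (size (Y - i)) (𝟙 (Y i)) ⟨
    𝟙 (Y i) * (size (Y - i) + 𝟙 (Y i))
      ≡⟨ cong (𝟙 (Y i) *_) (sym (size-remove Y i)) ⟩
    𝟙 (Y i) * size Y
      ∎

pairs≡size*pred[size] : ∀ {n} (Y : Vector Bool n) → pairs Y ≡ size Y * pred (size Y)
pairs≡size*pred[size] Y = m+n≡n*n⇒m≡n*pred[n] (pairs+size≡size² Y)

colour-absent⇒monochromatic : ∀ {n} (ℓ : Subset n) (c : Colouring n) →
  size (lookup ℓ ∩ c) ≡ 0 ⊎ size (lookup ℓ ∩ ∁ c) ≡ 0 → Monochromatic c ℓ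
colour-absent⇒monochromatic ℓ c (inj₁ no-red) = inj₂ λ p p∈ℓ →
  subst (λ x → x ∧ c p ≡ false) ([]=⇒lookup p∈ℓ) (size≡0⇒empty (lookup ℓ ∩ c) no-red p)
colour-absent⇒monochromatic ℓ c (inj₂ no-blue) = inj₁ λ p p∈ℓ → not-injective
  (subst (λ x → x ∧ not (c p) ≡ false) ([]=⇒lookup p∈ℓ) (size≡0⇒empty (lookup ℓ ∩ ∁ c) no-blue p))

line-bound : ∀ {n} (ℓ : Subset n) (c : Colouring n) → 2 ≤ ∣ ℓ ∣ → ∣ ℓ ∣ ≤ 3 →
  6 * pairs (lookup ℓ ∩ c) + 6 * pairs (lookup ℓ ∩ ∁ c) + 4 * 𝟙 (does (∣ ℓ ∣ ≟ 2))
    ≤ 24 * 𝟙 (does (monochromatic? c ℓ)) + 2 * pairs (lookup ℓ)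
line-bound ℓ c 2≤∣ℓ∣ ∣ℓ∣≤3 = begin
  6 * pairs (L ∩ c) + 6 * pairs (L ∩ ∁ c) + 4 * 𝟙 (does (∣ ℓ ∣ ≟ 2))
    ≡⟨ cong₂ _+_ (cong₂ (λ x y → 6 * x + 6 * y) (pairs≡size*pred[size] (L ∩ c)) (pairs≡size*pred[size] (L ∩ ∁ c)))
                 (cong (λ s → 4 * 𝟙 (does (s ≟ 2))) ∣ℓ∣≡r+b) ⟩
  6 * (r * pred r) + 6 * (b * pred b) + 4 * 𝟙 (does (r + b ≟ 2))
    ≤⟨ two-colour-bound r b m (subst (2 ≤_) ∣ℓ∣≡r+b 2≤∣ℓ∣) (subst (_≤ 3) ∣ℓ∣≡r+b ∣ℓ∣≤3) mono ⟩
  24 * m + 2 * ((r + b) * pred (r + b))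
    ≡⟨ cong (λ s → 24 * m + 2 * (s * pred s)) (size-split L c) ⟨
  24 * m + 2 * (size L * pred (size L))
    ≡⟨ cong (λ x → 24 * m + 2 * x) (pairs≡size*pred[size] L) ⟨
  24 * m + 2 * pairs L
    ∎
  where
  open ≤-Reasoning
  L = lookup ℓ
  r = size (L ∩ c)
  b = size (L ∩ ∁ c)
  m = 𝟙 (does (monochromatic? c ℓ))
  ∣ℓ∣≡r+b : ∣ ℓ ∣ ≡ r + b
  ∣ℓ∣≡r+b = trans (∣p∣≡size ℓ) (size-split L c)
  mono : r ≡ 0 ⊎ b ≡ 0 → m ≡ 1
  mono = cong 𝟙 ∘ dec-true (monochromatic? c ℓ) ∘ colour-absent⇒monochromatic ℓ c

module _ {n} (G : Geometry n) where

  private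
    m = length (lines G)
    line : Fin m → Vector Bool n
    line = lookup ∘ List.lookup (lines G)

  lines-through-two-points : ∀ {i j} → i ≢ j → ∑ˡ (lines G) (λ ℓ → 𝟙 (lookup ℓ i ∧ lookup ℓ j)) ≡ 1
  lines-through-two-points {i} {j} i≢j with joinExists G i j i≢j
  ... | ℓ , ℓ∈G , i∈ℓ , j∈ℓ =
    ∑ˡ-𝟙-unique (λ ℓ → lookup ℓ i ∧ lookup ℓ j) (distinct G) ℓ∈G
      (cong₂ _∧_ ([]=⇒lookup i∈ℓ) ([]=⇒lookup j∈ℓ))
      λ {ℓ′} ℓ′∈G ij∈ℓ′ → joinUnique G i j i≢j ℓ′ ℓ ℓ′∈G ℓ∈G
        (lookup⇒[]= i ℓ′ (∧-conicalˡ _ _ ij∈ℓ′)) (lookup⇒[]= j ℓ′ (∧-conicalʳ _ _ ij∈ℓ′)) i∈ℓ j∈ℓ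

  ∑-pairs-on-lines : ∀ Y → ∑ˡ (lines G) (λ ℓ → pairs (lookup ℓ ∩ Y)) ≡ pairs Y
  ∑-pairs-on-lines Y = begin
    ∑[ k < m ] ∑[ i < n ] ∑[ j < n ] on-line k i j  ≡⟨ ∑-comm (λ k i → ∑[ j < n ] on-line k i j) ⟩
    ∑[ i < n ] ∑[ k < m ] ∑[ j < n ] on-line k i j  ≡⟨ sum-cong-≗ (λ i → ∑-comm (λ k j → on-line k i j)) ⟩
    ∑[ i < n ] ∑[ j < n ] ∑[ k < m ] on-line k i j  ≡⟨ sum-cong-≗ (sum-cong-≗ ∘ on-pair) ⟩
    pairs Y                                         ∎
    where
    open ≡-Reasoning
    on-line : Fin m → Fin n → Fin n → ℕ
    on-line k i j = 𝟙 (i ≠ j ∧ (line k ∩ Y) i ∧ (line k ∩ Y) j)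
    on-pair : ∀ i j → ∑[ k < m ] on-line k i j ≡ 𝟙 (i ≠ j ∧ Y i ∧ Y j)
    on-pair i j = begin
      ∑[ k < m ] on-line k i j
        ≡⟨ sum-cong-≗ (λ k → 𝟙-regroup (i ≠ j) (line k i) (Y i) (line k j) (Y j)) ⟩
      ∑[ k < m ] (𝟙 (line k i ∧ line k j) * 𝟙 (i ≠ j ∧ Y i ∧ Y j))
        ≡⟨ *-distribʳ-sum (𝟙 (i ≠ j ∧ Y i ∧ Y j)) (λ k → 𝟙 (line k i ∧ line k j)) ⟨
      ∑[ k < m ] 𝟙 (line k i ∧ line k j) * 𝟙 (i ≠ j ∧ Y i ∧ Y j)
        ≡⟨ x*𝟙[¬P∧b]≡𝟙[¬P∧b] (i Fin.≟ j) (Y i ∧ Y j) lines-through-two-points ⟩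
      𝟙 (i ≠ j ∧ Y i ∧ Y j)
        ∎

  ∑-pairs-of-lines : ∑ˡ (lines G) (pairs ∘ lookup) ≡ pairs (replicate n true)
  ∑-pairs-of-lines = trans (sum-cong-≗ λ k → pairs-cong λ i → sym (∧-identityʳ (line k i)))
                           (∑-pairs-on-lines (replicate n true))

  summed-line-bound : (∀ ℓ → ℓ ∈ lines G → ∣ ℓ ∣ ≤ 3) → (c : Colouring n) →
    6 * pairs c + 6 * pairs (∁ c) + 4 * t₂ G ≤ 24 * monoCount G c + 2 * pairs (replicate n true)
  summed-line-bound short c = begin
    6 * pairs c + 6 * pairs (∁ c) + 4 * t₂ G
      ≡⟨ cong₂ _+_ (cong₂ (λ x y → 6 * x + 6 * y) (∑-pairs-on-lines c) (∑-pairs-on-lines (∁ c)))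
                   (cong (4 *_) (sym (length-filter≡∑ˡ (λ ℓ → ∣ ℓ ∣ ≟ 2) (lines G)))) ⟨
    6 * sum red + 6 * sum blue + 4 * sum two-point
      ≡⟨ cong₂ _+_ (∑-linear 6 6 red blue) (sym (*-distribˡ-sum 4 two-point)) ⟨
    ∑[ k < m ] (6 * red k + 6 * blue k) + ∑[ k < m ] (4 * two-point k)
      ≡⟨ ∑-distrib-+ (λ k → 6 * red k + 6 * blue k) (λ k → 4 * two-point k) ⟨
    ∑[ k < m ] (6 * red k + 6 * blue k + 4 * two-point k)
      ≤⟨ ∑-mono-≤ (λ k → line-bound (List.lookup (lines G) k) c
                            (lineSize≥2 G _ (∈-lookup k)) (short _ (∈-lookup k))) ⟩
    ∑[ k < m ] (24 * mono k + 2 * pairs (line k))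
      ≡⟨ ∑-linear 24 2 mono (pairs ∘ line) ⟩
    24 * sum mono + 2 * sum (pairs ∘ line)
      ≡⟨ cong₂ _+_ (cong (24 *_) (sym (length-filter≡∑ˡ (monochromatic? c) (lines G))))
                   (cong (2 *_) ∑-pairs-of-lines) ⟩
    24 * monoCount G c + 2 * pairs (replicate n true)
      ∎
    where
    open ≤-Reasoning
    red blue two-point mono : Fin m → ℕ
    red k    = pairs (line k ∩ c)
    blue k   = pairs (line k ∩ ∁ c)
    two-point k = 𝟙 (does (∣ List.lookup (lines G) k ∣ ≟ 2))
    mono k   = 𝟙 (does (monochromatic? c (List.lookup (lines G) k)))

lemma2p3 : (n : ℕ) (G : Geometry n) →
    (∀ ℓ → ℓ ∈ lines G → ∣ ℓ ∣ ≤ 3) →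
    (c : Colouring n) →
    n * n + 4 * t₂ G ≤ 24 * monoCount G c + 4 * n
lemma2p3 n G short c =
  quadratic-bound {size c} {size (∁ c)} {d = pairs (replicate n true)} {t₂ G} {monoCount G c}
    red+blue≡n (pairs+size≡size² c) (pairs+size≡size² (∁ c)) all-pairs (summed-line-bound G short c)
  where
  red+blue≡n : size c + size (∁ c) ≡ n
  red+blue≡n = trans (sym (size-split (replicate n true) c)) (size-replicate-true n)
  all-pairs : pairs (replicate n true) + n ≡ n * n
  all-pairs = subst (λ s → pairs (replicate n true) + s ≡ s * s) (size-replicate-true n)
                    (pairs+size≡size² (replicate n true))
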